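{- Let $n,r\in\mathbb N$ with $r\geq 3$ and $n=kr$ for some integer $k\geq 2$. Let $D\in\mathbb N$ with $n/(r-1)\leq D\leq n-r$. Then there exists a graph $G_2$ on $n$ vertices with $\Delta(G_2)=D$ and $$e(G_2)=D+e(\overline{T}(n-D-1,r-2))$$ such that $G_2$ does not have an equitable $n/r$-colouring.
   Context: An equitable $k$-colouring of a graph is a proper vertex colouring with $k$ colours in which any two colour classes differ in size by at most one. $T(m,s)$ denotes the Turán graph: the complete $s$-partite graph on $m$ vertices whose vertex classes have sizes $\lfloor m/s\rfloor$ or $\lceil m/s\rceil$ (for $s=1$ the edgeless graph), and $\overline{T}(m,s)$ denotes its complement. $\Delta(\cdot)$ is the maximum degree and $e(\cdot)$ the number of edges. -}

module Defs where

open import Data.Nat using (ℕ; zero; suc; _+_; _<ᵇ_; _⊔_; _%_; _≤_)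
open import Data.Nat.Properties using ()
open import Data.Bool using (Bool; true; false; _∧_; not; if_then_else_)
open import Data.Fin using (Fin; toℕ)
open import Data.Fin.Properties using () renaming (_≟_ to _≟ᶠ_)
open import Data.List using (List; allFin; map; foldr; filterᵇ; length)
open import Data.Product using (Σ; _×_; _,_)
open import Relation.Nullary using (¬_; does; yes; no)
open import Relation.Binary.Definitions using (DecidableEquality)
open import Data.Empty using (⊥-elim)
open import Relation.Binary.PropositionalEquality using (_≡_; _≢_; refl; sym; cong; cong₂)
import Data.Nat as N

record Graph (n : ℕ) : Set where
  field
    adj     : Fin n → Fin n → Bool
    symm    : ∀ u v → adj u v ≡ adj v u
    irrefl  : ∀ v → adj v v ≡ false
open Graph public

countFin : (n : ℕ) → (Fin n → Bool) → ℕ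
countFin n p = length (filterᵇ p (allFin n))

degree : {n : ℕ} → Graph n → Fin n → ℕ
degree {n} G v = countFin n (adj G v)

-- maximum degree Δ(G) (0 for the graph with no vertices)
Δ : {n : ℕ} → Graph n → ℕ
Δ {n} G = foldr _⊔_ 0 (map (degree G) (allFin n))

e : {n : ℕ} → Graph n → ℕ
e {n} G = foldr _+_ 0 (map (λ u → countFin n (λ v → (toℕ u <ᵇ toℕ v) ∧ adj G u v)) (allFin n))

eqb : {A : Set} → DecidableEquality A → A → A → Bool
eqb _≟_ x y = does (x ≟ y)

eqb-sym : {A : Set} (d : DecidableEquality A) (x y : A) → eqb d x y ≡ eqb d y x
eqb-sym d x y with d x y | d y x
... | yes _ | yes _ = refl
... | no _  | no _  = refl
... | yes p | no q  = ⊥-elim (q (sym p))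
... | no q  | yes p = ⊥-elim (q (sym p))

eqb-refl : {A : Set} (d : DecidableEquality A) (x : A) → eqb d x x ≡ true
eqb-refl d x with d x x
... | yes _ = refl
... | no q  = ⊥-elim (q refl)

complement : {n : ℕ} → Graph n → Graph n
complement {n} G = record
  { adj    = λ u v → not (eqb _≟ᶠ_ u v) ∧ not (adj G u v)
  ; symm   = λ u v → cong₂ (λ a b → not a ∧ not b) (eqb-sym _≟ᶠ_ u v) (symm G u v)
  ; irrefl = λ v → cong (λ a → not a ∧ not (adj G v v)) (eqb-refl _≟ᶠ_ v)
  }

-- This gives s classes
-- of sizes ⌊m/s⌋ or ⌈m/s⌉.  (For s = 0, which never occurs in the statement
-- since there s = r - 2 ≥ 1, all vertices are put in one class.)
turanClass : {m : ℕ} (s : ℕ) → Fin m → ℕ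
turanClass zero    i = 0
turanClass (suc s) i = toℕ i % suc s

-- Turán graph T(m,s): complete s-partite graph; distinct vertices adjacent iff
-- they lie in different classes (for s = 1 it is edgeless).
T : (m s : ℕ) → Graph m
T m s = record
  { adj    = λ u v → not (eqb N._≟_ (turanClass s u) (turanClass s v))
  ; symm   = λ u v → cong not (eqb-sym N._≟_ (turanClass s u) (turanClass s v))
  ; irrefl = λ v → cong not (eqb-refl N._≟_ (turanClass s v))
  }

T̄ : (m s : ℕ) → Graph m
T̄ m s = complement (T m s)

Proper : {n k : ℕ} → Graph n → (Fin n → Fin k) → Set
Proper G c = ∀ u v → adj G u v ≡ true → c u ≢ c v

classSize : {n k : ℕ} → (Fin n → Fin k) → Fin k → ℕ
classSize {n} c a = countFin n (λ v → eqb _≟ᶠ_ (c v) a)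

EquitableColouring : {n : ℕ} → Graph n → (k : ℕ) → (Fin n → Fin k) → Set
EquitableColouring {n} G k c = Proper G c × (∀ a b → classSize c a ≤ suc (classSize c b))

HasEquitableColouring : {n : ℕ} → Graph n → ℕ → Set
HasEquitableColouring {n} G k = Σ (Fin n → Fin k) (EquitableColouring G k)

-- G₂ is the disjoint union of T̄(n−D−1, r−2), a union of r−2 cliques, with the star K₁,D.
-- Each clique has at most ⌈(n−D−1)/(r−2)⌉ ≤ D vertices, so Δ(G₂) = D. In a proper colouring
-- the colour class of the star's centre contains no leaf and at most one vertex of each clique,
-- so it has at most r−1 vertices; but an equitable colouring of n = kr vertices with k colours
-- has all its classes of size exactly r.

module Submission where

open import Defs
open import Data.Nat using (ℕ; zero; suc; _+_; _*_; _∸_; _≤_; _<_; z≤n; s≤s; z<s; _⊔_; _%_; _/_; _<ᵇ_; _≤?_)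
open import Data.Nat.Properties
  using ( +-0-commutativeMonoid; +-assoc; +-comm; +-identityʳ; *-identityʳ; *-suc
        ; ≤-refl; ≤-reflexive; ≤-trans; ≤-antisym; <-≤-trans; <-irrefl; ≰⇒>; <⇒≱; module ≤-Reasoning
        ; +-mono-≤; +-monoˡ-≤; m<m+n; +-mono-<-≤; +-mono-≤-<; m≤m+n
        ; ⊔-lub; m≤m⊔n; m≤n⊔m; m≤n⇒m⊔n≡n
        ; m∸n≤m; ∸-monoˡ-≤; ∸-+-assoc; m∸n+n≡m; m+n∸m≡n )
import Data.Nat as ℕ
open import Data.Nat.DivMod using (_mod_; m≡m%n+[m/n]*n; m<n*o⇒m/o<n)
open import Data.Bool using (Bool; true; false; _∧_; not)
open import Data.Bool.Properties using (∧-conicalˡ; ∧-conicalʳ; ∧-zeroʳ; not-involutive)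
open import Data.Fin using (Fin; toℕ; fromℕ<; _↑ˡ_; _↑ʳ_; splitAt) renaming (zero to fzero; suc to fsuc)
open import Data.Fin.Properties using (toℕ<n; toℕ-injective; toℕ-fromℕ<; toℕ-↑ˡ; toℕ-↑ʳ; splitAt-↑ˡ; splitAt-↑ʳ)
  renaming (_≟_ to _≟ᶠ_; suc-injective to fsuc-injective)
import Data.List as List
open import Data.List using (allFin; filterᵇ; length)
open import Data.List.Properties using (map-tabulate)
import Data.Vec.Functional as Vector
open import Data.Vec.Functional using (Vector)
open import Data.Sum using (_⊎_; inj₁; inj₂; [_,_]′)
open import Data.Product using (Σ; _×_; _,_)
open import Data.Empty using (⊥-elim)
open import Relation.Nullary using (¬_; yes; no)
open import Relation.Nullary.Decidable using (dec-true; dec-false)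
open import Relation.Binary.Definitions using (DecidableEquality)
open import Relation.Binary.PropositionalEquality using (_≡_; _≢_; refl; sym; trans; cong; cong₂; subst; _≗_; module ≡-Reasoning)
open import Function using (_∘_; id)
open import Algebra.Properties.CommutativeMonoid.Sum +-0-commutativeMonoid
  using (sum; sum-syntax; sum-cong-≗; sum-replicate-zero; ∑-comm)

eqb⇒≡ : {A : Set} (d : DecidableEquality A) {x y : A} → eqb d x y ≡ true → x ≡ y
eqb⇒≡ d {x} {y} eq with d x y
eqb⇒≡ d eq | yes x≡y = x≡y
eqb⇒≡ d () | no _

+-<ᵇ : ∀ m {x y} → (m + x <ᵇ m + y) ≡ (x <ᵇ y)
+-<ᵇ zero    = refl
+-<ᵇ (suc m) = +-<ᵇ m

%-/-injective : ∀ d .{{_ : ℕ.NonZero d}} {x y} → x % d ≡ y % d → x / d ≡ y / d → x ≡ y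
%-/-injective d {x} {y} rem quot = begin
  x                  ≡⟨ m≡m%n+[m/n]*n x d ⟩
  x % d + x / d * d  ≡⟨ cong₂ (λ r q → r + q * d) rem quot ⟩
  y % d + y / d * d  ≡⟨ m≡m%n+[m/n]*n y d ⟨
  y                  ∎
  where open ≡-Reasoning

sum-↑ : ∀ m {n} (f : Vector ℕ (m + n)) → sum f ≡ sum (f ∘ (_↑ˡ n)) + sum (f ∘ (m ↑ʳ_))
sum-↑ zero    f = refl
sum-↑ (suc m) f = trans (cong (f fzero +_) (sum-↑ m (f ∘ fsuc))) (sym (+-assoc (f fzero) _ _))

∑-≤-* : ∀ {n b} (f : Vector ℕ n) → (∀ i → f i ≤ b) → sum f ≤ n * b
∑-≤-* {zero}  f f≤b = z≤n
∑-≤-* {suc n} f f≤b = +-mono-≤ (f≤b fzero) (∑-≤-* (f ∘ fsuc) (f≤b ∘ fsuc))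

∑-<-* : ∀ {n b} (f : Vector ℕ n) → (∀ i → f i ≤ b) → ∀ j → f j < b → sum f < n * b
∑-<-* {suc n} f f≤b fzero    fj<b = +-mono-<-≤ fj<b (∑-≤-* (f ∘ fsuc) (f≤b ∘ fsuc))
∑-<-* {suc n} f f≤b (fsuc j) fj<b = +-mono-≤-< (f≤b fzero) (∑-<-* (f ∘ fsuc) (f≤b ∘ fsuc) j fj<b)

foldr-tabulate : ∀ {n} (_∙_ : ℕ → ℕ → ℕ) ε (f : Vector ℕ n) →
  List.foldr _∙_ ε (List.tabulate f) ≡ Vector.foldr _∙_ ε f
foldr-tabulate {zero}  _∙_ ε f = refl
foldr-tabulate {suc n} _∙_ ε f = cong (f fzero ∙_) (foldr-tabulate _∙_ ε (f ∘ fsuc))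

foldr-map-allFin : ∀ {n} (_∙_ : ℕ → ℕ → ℕ) ε (f : Vector ℕ n) →
  List.foldr _∙_ ε (List.map f (allFin n)) ≡ Vector.foldr _∙_ ε f
foldr-map-allFin _∙_ ε f = trans (cong (List.foldr _∙_ ε) (map-tabulate id f)) (foldr-tabulate _∙_ ε f)

max-lub : ∀ {n b} (f : Vector ℕ n) → (∀ i → f i ≤ b) → Vector.foldr _⊔_ 0 f ≤ b
max-lub {zero}  f f≤b = z≤n
max-lub {suc n} f f≤b = ⊔-lub (f≤b fzero) (max-lub (f ∘ fsuc) (f≤b ∘ fsuc))

max-upper : ∀ {n} (f : Vector ℕ n) i → f i ≤ Vector.foldr _⊔_ 0 f
max-upper f fzero    = m≤m⊔n (f fzero) _
max-upper f (fsuc i) = ≤-trans (max-upper (f ∘ fsuc) i) (m≤n⊔m (f fzero) _)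

𝟙 : Bool → ℕ
𝟙 true  = 1
𝟙 false = 0

count : (n : ℕ) → (Fin n → Bool) → ℕ
count n p = ∑[ i < n ] 𝟙 (p i)

length-filterᵇ-tabulate : ∀ {A : Set} n (p : A → Bool) (f : Fin n → A) →
  length (filterᵇ p (List.tabulate f)) ≡ count n (p ∘ f)
length-filterᵇ-tabulate zero    p f = refl
length-filterᵇ-tabulate (suc n) p f with p (f fzero)
... | true  = cong suc (length-filterᵇ-tabulate n p (f ∘ fsuc))
... | false = length-filterᵇ-tabulate n p (f ∘ fsuc)

countFin≡count : ∀ n p → countFin n p ≡ count n p
countFin≡count n p = length-filterᵇ-tabulate n p id

count-cong : ∀ {n} {p q : Fin n → Bool} → p ≗ q → count n p ≡ count n q
count-cong p≗q = sum-cong-≗ (cong 𝟙 ∘ p≗q)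

count-false : ∀ {n} (p : Fin n → Bool) → (∀ i → p i ≡ false) → count n p ≡ 0
count-false {n} p p≡false = trans (count-cong p≡false) (sum-replicate-zero n)

count-true : ∀ n → count n (λ _ → true) ≡ n
count-true zero    = refl
count-true (suc n) = cong suc (count-true n)

count-↑ : ∀ m {n} (p : Fin (m + n) → Bool) →
  count (m + n) p ≡ count m (p ∘ (_↑ˡ n)) + count n (p ∘ (m ↑ʳ_))
count-↑ m p = sum-↑ m (𝟙 ∘ p)

count-splitAt : ∀ m {n} (q : Fin m ⊎ Fin n → Bool) →
  count (m + n) (q ∘ splitAt m) ≡ count m (λ a → q (inj₁ a)) + count n (λ j → q (inj₂ j))
count-splitAt m {n} q = trans (count-↑ m (q ∘ splitAt m)) (cong₂ _+_
  (count-cong λ a → cong q (splitAt-↑ˡ m a n))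
  (count-cong λ j → cong q (splitAt-↑ʳ m n j)))

count-mono : ∀ {n} (p q : Fin n → Bool) → (∀ i → p i ≡ true → q i ≡ true) → count n p ≤ count n q
count-mono {zero}  p q p⇒q = z≤n
count-mono {suc n} p q p⇒q = +-mono-≤ head-≤ (count-mono (p ∘ fsuc) (q ∘ fsuc) (p⇒q ∘ fsuc))
  where
  head-≤ : 𝟙 (p fzero) ≤ 𝟙 (q fzero)
  head-≤ with p fzero in eq
  ... | false = z≤n
  ... | true  rewrite p⇒q fzero eq = ≤-refl

count-≤1 : ∀ {n} (p : Fin n → Bool) → (∀ x y → p x ≡ true → p y ≡ true → x ≡ y) → count n p ≤ 1
count-≤1 {zero}  p unique = z≤n
count-≤1 {suc n} p unique with p fzero in p0
... | true  = ≤-reflexive (cong suc (count-false (p ∘ fsuc) rest-false))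
  where
  rest-false : ∀ i → p (fsuc i) ≡ false
  rest-false i with p (fsuc i) in pi
  ... | false = refl
  ... | true with unique fzero (fsuc i) p0 pi
  ... | ()
... | false = count-≤1 (p ∘ fsuc) λ x y px py → fsuc-injective (unique (fsuc x) (fsuc y) px py)

∑-𝟙-eqb : ∀ {k} (b : Bool) (x : Fin k) → ∑[ a < k ] 𝟙 (b ∧ eqb _≟ᶠ_ x a) ≡ 𝟙 b
∑-𝟙-eqb {k}     false x        = sum-replicate-zero k
∑-𝟙-eqb {suc k} true  fzero    = cong suc (sum-replicate-zero k)
∑-𝟙-eqb {suc k} true  (fsuc x) = ∑-𝟙-eqb true x

count-fibres : ∀ {n k} (p : Fin n → Bool) (f : Fin n → Fin k) →
  ∑[ a < k ] count n (λ v → p v ∧ eqb _≟ᶠ_ (f v) a) ≡ count n p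
count-fibres {n} {k} p f = trans (∑-comm {k} {n} (λ a v → 𝟙 (p v ∧ eqb _≟ᶠ_ (f v) a)))
                                 (sum-cong-≗ λ v → ∑-𝟙-eqb (p v) (f v))

count-≤-injectiveOn : ∀ {n k} (p : Fin n → Bool) (f : Fin n → Fin k) →
  (∀ x y → p x ≡ true → p y ≡ true → f x ≡ f y → x ≡ y) → count n p ≤ k
count-≤-injectiveOn {n} {k} p f injective = begin
  count n p                                             ≡⟨ count-fibres p f ⟨
  ∑[ a < k ] count n (λ v → p v ∧ eqb _≟ᶠ_ (f v) a)    ≤⟨ ∑-≤-* _ fibre-≤1 ⟩
  k * 1                                                 ≡⟨ *-identityʳ k ⟩
  k                                                     ∎
  where
  open ≤-Reasoning
  fibre-≤1 : ∀ a → count n (λ v → p v ∧ eqb _≟ᶠ_ (f v) a) ≤ 1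
  fibre-≤1 a = count-≤1 _ λ x y hx hy →
    injective x y (∧-conicalˡ _ _ hx) (∧-conicalˡ _ _ hy)
      (trans (eqb⇒≡ _≟ᶠ_ (∧-conicalʳ _ _ hx)) (sym (eqb⇒≡ _≟ᶠ_ (∧-conicalʳ _ _ hy))))

Δ≡max : ∀ {n} (G : Graph n) → Δ G ≡ Vector.foldr _⊔_ 0 (degree G)
Δ≡max G = foldr-map-allFin _⊔_ 0 (degree G)

Δ-lub : ∀ {n b} (G : Graph n) → (∀ v → degree G v ≤ b) → Δ G ≤ b
Δ-lub G deg≤b = subst (_≤ _) (sym (Δ≡max G)) (max-lub (degree G) deg≤b)

degree≤Δ : ∀ {n} (G : Graph n) v → degree G v ≤ Δ G
degree≤Δ G v = subst (degree G v ≤_) (sym (Δ≡max G)) (max-upper (degree G) v)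

forwardDegree : ∀ {n} → Graph n → Fin n → ℕ
forwardDegree {n} G u = count n (λ v → (toℕ u <ᵇ toℕ v) ∧ adj G u v)

e≡∑forwardDegree : ∀ {n} (G : Graph n) → e G ≡ ∑[ u < n ] forwardDegree G u
e≡∑forwardDegree {n} G =
  trans (foldr-map-allFin {n} _+_ 0 _)
        (sum-cong-≗ λ u → countFin≡count n (λ v → (toℕ u <ᵇ toℕ v) ∧ adj G u v))

sumAdj : ∀ {m n} → Graph m → Graph n → Fin m ⊎ Fin n → Fin m ⊎ Fin n → Bool
sumAdj G H (inj₁ a) (inj₁ b) = adj G a b
sumAdj G H (inj₂ a) (inj₂ b) = adj H a b
sumAdj G H (inj₁ _) (inj₂ _) = false
sumAdj G H (inj₂ _) (inj₁ _) = false

sumAdj-symm : ∀ {m n} (G : Graph m) (H : Graph n) x y → sumAdj G H x y ≡ sumAdj G H y x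
sumAdj-symm G H (inj₁ a) (inj₁ b) = symm G a b
sumAdj-symm G H (inj₂ a) (inj₂ b) = symm H a b
sumAdj-symm G H (inj₁ _) (inj₂ _) = refl
sumAdj-symm G H (inj₂ _) (inj₁ _) = refl

sumAdj-irrefl : ∀ {m n} (G : Graph m) (H : Graph n) x → sumAdj G H x x ≡ false
sumAdj-irrefl G H (inj₁ a) = irrefl G a
sumAdj-irrefl G H (inj₂ a) = irrefl H a

infixr 5 _⊕_

_⊕_ : ∀ {m n} → Graph m → Graph n → Graph (m + n)
_⊕_ {m} G H = record
  { adj    = λ u v → sumAdj G H (splitAt m u) (splitAt m v)
  ; symm   = λ u v → sumAdj-symm G H (splitAt m u) (splitAt m v)
  ; irrefl = λ v → sumAdj-irrefl G H (splitAt m v)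
  }

degree-⊕ : ∀ {m n} (G : Graph m) (H : Graph n) v →
  degree (G ⊕ H) v ≡ [ degree G , degree H ]′ (splitAt m v)
degree-⊕ {m} {n} G H v = trans (countFin≡count (m + n) _)
  (trans (count-splitAt m (sumAdj G H (splitAt m v))) (row (splitAt m v)))
  where
  row : ∀ x → count m (λ a → sumAdj G H x (inj₁ a)) + count n (λ j → sumAdj G H x (inj₂ j))
              ≡ [ degree G , degree H ]′ x
  row (inj₁ a) = trans (cong (count m (adj G a) +_) (sum-replicate-zero n))
                       (trans (+-identityʳ _) (sym (countFin≡count m _)))
  row (inj₂ j) = trans (cong (_+ count n (adj H j)) (sum-replicate-zero m)) (sym (countFin≡count n _))

degree-⊕ˡ : ∀ {m n} (G : Graph m) (H : Graph n) a → degree (G ⊕ H) (a ↑ˡ n) ≡ degree G a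
degree-⊕ˡ {m} {n} G H a = trans (degree-⊕ G H (a ↑ˡ n)) (cong [ degree G , degree H ]′ (splitAt-↑ˡ m a n))

degree-⊕ʳ : ∀ {m n} (G : Graph m) (H : Graph n) j → degree (G ⊕ H) (m ↑ʳ j) ≡ degree H j
degree-⊕ʳ {m} {n} G H j = trans (degree-⊕ G H (m ↑ʳ j)) (cong [ degree G , degree H ]′ (splitAt-↑ʳ m n j))

forwardDegree-⊕ˡ : ∀ {m n} (G : Graph m) (H : Graph n) a →
  forwardDegree (G ⊕ H) (a ↑ˡ n) ≡ forwardDegree G a
forwardDegree-⊕ˡ {m} {n} G H a = trans (count-↑ m _)
  (trans (cong₂ _+_ (count-cong within) (count-false _ across)) (+-identityʳ _))
  where
  within : ∀ b → ((toℕ (a ↑ˡ n) <ᵇ toℕ (b ↑ˡ n)) ∧ adj (G ⊕ H) (a ↑ˡ n) (b ↑ˡ n))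
                 ≡ ((toℕ a <ᵇ toℕ b) ∧ adj G a b)
  within b rewrite toℕ-↑ˡ a n | toℕ-↑ˡ b n | splitAt-↑ˡ m a n | splitAt-↑ˡ m b n = refl
  across : ∀ j → ((toℕ (a ↑ˡ n) <ᵇ toℕ (m ↑ʳ j)) ∧ adj (G ⊕ H) (a ↑ˡ n) (m ↑ʳ j)) ≡ false
  across j rewrite splitAt-↑ˡ m a n | splitAt-↑ʳ m n j = ∧-zeroʳ _

forwardDegree-⊕ʳ : ∀ {m n} (G : Graph m) (H : Graph n) j →
  forwardDegree (G ⊕ H) (m ↑ʳ j) ≡ forwardDegree H j
forwardDegree-⊕ʳ {m} {n} G H j = trans (count-↑ m _)
  (cong₂ _+_ (count-false _ across) (count-cong within))
  where
  across : ∀ b → ((toℕ (m ↑ʳ j) <ᵇ toℕ (b ↑ˡ n)) ∧ adj (G ⊕ H) (m ↑ʳ j) (b ↑ˡ n)) ≡ false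
  across b rewrite splitAt-↑ʳ m n j | splitAt-↑ˡ m b n = ∧-zeroʳ _
  within : ∀ i → ((toℕ (m ↑ʳ j) <ᵇ toℕ (m ↑ʳ i)) ∧ adj (G ⊕ H) (m ↑ʳ j) (m ↑ʳ i))
                 ≡ ((toℕ j <ᵇ toℕ i) ∧ adj H j i)
  within i rewrite toℕ-↑ʳ m j | toℕ-↑ʳ m i | splitAt-↑ʳ m n j | splitAt-↑ʳ m n i =
    cong (_∧ adj H j i) (+-<ᵇ m)

e-⊕ : ∀ {m n} (G : Graph m) (H : Graph n) → e (G ⊕ H) ≡ e G + e H
e-⊕ {m} {n} G H = begin
  e (G ⊕ H)                                      ≡⟨ e≡∑forwardDegree (G ⊕ H) ⟩
  ∑[ u < m + n ] forwardDegree (G ⊕ H) u         ≡⟨ sum-↑ m _ ⟩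
  ∑[ a < m ] forwardDegree (G ⊕ H) (a ↑ˡ n)
    + ∑[ j < n ] forwardDegree (G ⊕ H) (m ↑ʳ j)  ≡⟨ cong₂ _+_ (sum-cong-≗ (forwardDegree-⊕ˡ G H))
                                                               (sum-cong-≗ (forwardDegree-⊕ʳ G H)) ⟩
  ∑[ a < m ] forwardDegree G a
    + ∑[ j < n ] forwardDegree H j               ≡⟨ cong₂ _+_ (e≡∑forwardDegree G) (e≡∑forwardDegree H) ⟨
  e G + e H                                      ∎
  where open ≡-Reasoning

Δ-⊕ : ∀ {m n} (G : Graph m) (H : Graph n) → Δ (G ⊕ H) ≡ Δ G ⊔ Δ H
Δ-⊕ {m} {n} G H = ≤-antisym
  (Δ-lub (G ⊕ H) λ v → subst (_≤ Δ G ⊔ Δ H) (sym (degree-⊕ G H v)) (bounded (splitAt m v)))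
  (⊔-lub (Δ-lub G λ a → subst (_≤ Δ (G ⊕ H)) (degree-⊕ˡ G H a) (degree≤Δ (G ⊕ H) (a ↑ˡ n)))
         (Δ-lub H λ j → subst (_≤ Δ (G ⊕ H)) (degree-⊕ʳ G H j) (degree≤Δ (G ⊕ H) (m ↑ʳ j))))
  where
  bounded : ∀ x → [ degree G , degree H ]′ x ≤ Δ G ⊔ Δ H
  bounded (inj₁ a) = ≤-trans (degree≤Δ G a) (m≤m⊔n (Δ G) (Δ H))
  bounded (inj₂ j) = ≤-trans (degree≤Δ H j) (m≤n⊔m (Δ G) (Δ H))

Proper-⊕ˡ : ∀ {m n k} (G : Graph m) (H : Graph n) {c : Fin (m + n) → Fin k} →
  Proper (G ⊕ H) c → Proper G (c ∘ (_↑ˡ n))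
Proper-⊕ˡ {m} {n} G H proper a b ab = proper (a ↑ˡ n) (b ↑ˡ n) edge
  where
  edge : adj (G ⊕ H) (a ↑ˡ n) (b ↑ˡ n) ≡ true
  edge rewrite splitAt-↑ˡ m a n | splitAt-↑ˡ m b n = ab

Proper-⊕ʳ : ∀ {m n k} (G : Graph m) (H : Graph n) {c : Fin (m + n) → Fin k} →
  Proper (G ⊕ H) c → Proper H (c ∘ (m ↑ʳ_))
Proper-⊕ʳ {m} {n} G H proper i j ij = proper (m ↑ʳ i) (m ↑ʳ j) edge
  where
  edge : adj (G ⊕ H) (m ↑ʳ i) (m ↑ʳ j) ≡ true
  edge rewrite splitAt-↑ʳ m n i | splitAt-↑ʳ m n j = ij

starAdj : ∀ {D} → Fin (suc D) → Fin (suc D) → Bool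
starAdj fzero    fzero    = false
starAdj fzero    (fsuc _) = true
starAdj (fsuc _) fzero    = true
starAdj (fsuc _) (fsuc _) = false

starAdj-symm : ∀ {D} (i j : Fin (suc D)) → starAdj i j ≡ starAdj j i
starAdj-symm fzero    fzero    = refl
starAdj-symm fzero    (fsuc _) = refl
starAdj-symm (fsuc _) fzero    = refl
starAdj-symm (fsuc _) (fsuc _) = refl

starAdj-irrefl : ∀ {D} (i : Fin (suc D)) → starAdj i i ≡ false
starAdj-irrefl fzero    = refl
starAdj-irrefl (fsuc _) = refl

star : (D : ℕ) → Graph (suc D)
star D = record { adj = starAdj ; symm = starAdj-symm ; irrefl = starAdj-irrefl }

degree-star-centre : ∀ D → degree (star D) fzero ≡ D
degree-star-centre D = trans (countFin≡count (suc D) (starAdj fzero)) (count-true D)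

degree-star-leaf : ∀ {D} (t : Fin D) → degree (star D) (fsuc t) ≡ 1
degree-star-leaf {D} t = trans (countFin≡count (suc D) (starAdj (fsuc t))) (cong suc (sum-replicate-zero D))

Δ-star : ∀ D → Δ (star D) ≡ D
Δ-star D = ≤-antisym (Δ-lub (star D) bounded)
  (subst (_≤ Δ (star D)) (degree-star-centre D) (degree≤Δ (star D) fzero))
  where
  bounded : ∀ v → degree (star D) v ≤ D
  bounded fzero    = ≤-reflexive (degree-star-centre D)
  bounded (fsuc t) = subst (_≤ D) (sym (degree-star-leaf t)) (<-≤-trans z<s (toℕ<n t))

e-star : ∀ D → e (star D) ≡ D
e-star D = begin
  e (star D)                                                ≡⟨ e≡∑forwardDegree (star D) ⟩
  forwardDegree (star D) fzero
    + ∑[ t < D ] forwardDegree (star D) (fsuc t)            ≡⟨ cong₂ _+_ (count-true D) leaves ⟩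
  D + 0                                                     ≡⟨ +-identityʳ D ⟩
  D                                                         ∎
  where
  open ≡-Reasoning
  leafRow : ∀ t (v : Fin (suc D)) → ((toℕ (fsuc t) <ᵇ toℕ v) ∧ starAdj (fsuc t) v) ≡ false
  leafRow t fzero    = refl
  leafRow t (fsuc _) = ∧-zeroʳ _
  leaves : ∑[ t < D ] forwardDegree (star D) (fsuc t) ≡ 0
  leaves = trans (sum-cong-≗ {D} λ t → count-false _ (leafRow t)) (sum-replicate-zero D)

colourClass-star : ∀ {D k} {c : Fin (suc D) → Fin k} → Proper (star D) c →
  count (suc D) (λ j → eqb _≟ᶠ_ (c j) (c fzero)) ≡ 1
colourClass-star {c = c} proper = cong₂ _+_ (cong 𝟙 (eqb-refl _≟ᶠ_ (c fzero)))
  (count-false _ λ t → dec-false (c (fsuc t) ≟ᶠ c fzero) λ eq → proper fzero (fsuc t) refl (sym eq))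

T̄-adj⇒sameClass : ∀ {m} s {a b : Fin m} → adj (T̄ m s) a b ≡ true → turanClass s a ≡ turanClass s b
T̄-adj⇒sameClass s ab = eqb⇒≡ ℕ._≟_
  (trans (sym (not-involutive _)) (∧-conicalʳ _ _ ab))

sameClass⇒T̄-adj : ∀ {m} s {a b : Fin m} → a ≢ b → turanClass s a ≡ turanClass s b → adj (T̄ m s) a b ≡ true
sameClass⇒T̄-adj s {a} {b} a≢b same =
  cong₂ (λ x y → not x ∧ not (not y)) (dec-false (a ≟ᶠ b) a≢b) (dec-true (turanClass s a ℕ.≟ turanClass s b) same)

-- A vertex of T̄ is determined by its class (remainder mod s+1) and its quotient by s+1, and
-- the quotient is < D; so a clique has at most D vertices.
degree-T̄-≤ : ∀ {m D} s → m ≤ D * suc s → ∀ a → degree (T̄ m (suc s)) a ≤ D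
degree-T̄-≤ {m} {D} s m≤Ds a = begin
  degree (T̄ m (suc s)) a                         ≡⟨ countFin≡count m _ ⟩
  count m (adj (T̄ m (suc s)) a)                  ≤⟨ count-mono _ _ sameClass ⟩
  count m (λ b → eqb ℕ._≟_ (class a) (class b))  ≤⟨ count-≤-injectiveOn _ quotient injective ⟩
  D                                              ∎
  where
  open ≤-Reasoning
  class : Fin m → ℕ
  class b = toℕ b % suc s
  sameClass : ∀ b → adj (T̄ m (suc s)) a b ≡ true → eqb ℕ._≟_ (class a) (class b) ≡ true
  sameClass b ab = dec-true (class a ℕ.≟ class b) (T̄-adj⇒sameClass (suc s) {a} {b} ab)
  quotient : Fin m → Fin D
  quotient b = fromℕ< (m<n*o⇒m/o<n (<-≤-trans (toℕ<n b) m≤Ds))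
  injective : ∀ x y → eqb ℕ._≟_ (class a) (class x) ≡ true → eqb ℕ._≟_ (class a) (class y) ≡ true →
              quotient x ≡ quotient y → x ≡ y
  injective x y ax ay qxy = toℕ-injective (%-/-injective (suc s)
    (trans (sym (eqb⇒≡ ℕ._≟_ {class a} ax)) (eqb⇒≡ ℕ._≟_ {class a} ay))
    (trans (sym (toℕ-fromℕ< _)) (trans (cong toℕ qxy) (toℕ-fromℕ< _))))

Δ-T̄-≤ : ∀ {m D} s → m ≤ D * suc s → Δ (T̄ m (suc s)) ≤ D
Δ-T̄-≤ {m} s m≤Ds = Δ-lub (T̄ m (suc s)) (degree-T̄-≤ s m≤Ds)

-- Two distinct vertices in the same Turán class are adjacent in T̄, so cannot share a colour.
colourClass-T̄-≤ : ∀ {m k} s {c : Fin m → Fin k} → Proper (T̄ m (suc s)) c →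
  ∀ a → count m (λ b → eqb _≟ᶠ_ (c b) a) ≤ suc s
colourClass-T̄-≤ {m} s {c} proper a = count-≤-injectiveOn _ (λ b → toℕ b mod suc s) injective
  where
  injective : ∀ x y → eqb _≟ᶠ_ (c x) a ≡ true → eqb _≟ᶠ_ (c y) a ≡ true →
              toℕ x mod suc s ≡ toℕ y mod suc s → x ≡ y
  injective x y cx cy rxy with x ≟ᶠ y
  ... | yes x≡y = x≡y
  ... | no  x≢y = ⊥-elim (proper x y (sameClass⇒T̄-adj (suc s) x≢y sameClass)
                                     (trans (eqb⇒≡ _≟ᶠ_ cx) (sym (eqb⇒≡ _≟ᶠ_ cy))))
    where
    sameClass : toℕ x % suc s ≡ toℕ y % suc s
    sameClass = trans (sym (toℕ-fromℕ< _)) (trans (cong toℕ rxy) (toℕ-fromℕ< _))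

∑-classSize : ∀ {n k} (c : Fin n → Fin k) → ∑[ a < k ] classSize c a ≡ n
∑-classSize {n} {k} c = begin
  ∑[ a < k ] classSize c a                          ≡⟨ sum-cong-≗ (λ a → countFin≡count n (λ v → eqb _≟ᶠ_ (c v) a)) ⟩
  ∑[ a < k ] count n (λ v → eqb _≟ᶠ_ (c v) a)       ≡⟨ count-fibres (λ _ → true) c ⟩
  count n (λ _ → true)                              ≡⟨ count-true n ⟩
  n                                                 ∎
  where open ≡-Reasoning

balanced⇒≥ : ∀ {k r} (S : Vector ℕ k) → (∀ a b → S a ≤ suc (S b)) → sum S ≡ k * r → ∀ a → r ≤ S a
balanced⇒≥ {k} {r} S balanced ∑S≡kr a with r ≤? S a
... | yes r≤Sa = r≤Sa
... | no  r≰Sa = ⊥-elim (<-irrefl ∑S≡kr (∑-<-* S (λ b → ≤-trans (balanced b a) Sa<r) a Sa<r))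
  where
  Sa<r : S a < r
  Sa<r = ≰⇒> r≰Sa

centreClass-≤ : ∀ {m k} s D {c : Fin (m + suc D) → Fin k} → Proper (T̄ m (suc s) ⊕ star D) c →
  classSize c (c (m ↑ʳ fzero)) ≤ suc (suc s)
centreClass-≤ {m} {k} s D {c} proper = begin
  classSize c c₀                                   ≡⟨ countFin≡count (m + suc D) (λ v → eqb _≟ᶠ_ (c v) c₀) ⟩
  count (m + suc D) (λ v → eqb _≟ᶠ_ (c v) c₀)      ≡⟨ count-↑ m _ ⟩
  count m (λ b → eqb _≟ᶠ_ (c (b ↑ˡ suc D)) c₀)
    + count (suc D) (λ j → eqb _≟ᶠ_ (c (m ↑ʳ j)) c₀) ≤⟨ +-mono-≤ (colourClass-T̄-≤ s properˡ c₀)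
                                                              (≤-reflexive (colourClass-star properʳ)) ⟩
  suc s + 1                                        ≡⟨ +-comm (suc s) 1 ⟩
  suc (suc s)                                      ∎
  where
  open ≤-Reasoning
  c₀ : Fin k
  c₀ = c (m ↑ʳ fzero)
  properˡ : Proper (T̄ m (suc s)) (c ∘ (_↑ˡ suc D))
  properˡ = Proper-⊕ˡ (T̄ m (suc s)) (star D) proper
  properʳ : Proper (star D) (c ∘ (m ↑ʳ_))
  properʳ = Proper-⊕ʳ (T̄ m (suc s)) (star D) proper

T̄⊕star-notEquitable : ∀ {m k r} s D → m + suc D ≡ k * r → suc (suc s) < r →
  ¬ HasEquitableColouring (T̄ m (suc s) ⊕ star D) k
T̄⊕star-notEquitable {m} {k} {r} s D N≡kr ss<r (c , proper , balanced) = <⇒≱ ss<r (begin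
  r                             ≤⟨ balanced⇒≥ (classSize c) balanced (trans (∑-classSize c) N≡kr) c₀ ⟩
  classSize c c₀                ≤⟨ centreClass-≤ s D proper ⟩
  suc (suc s)                   ∎)
  where
  open ≤-Reasoning
  c₀ : Fin k
  c₀ = c (m ↑ʳ fzero)

Δ-T̄⊕star : ∀ {m} s D → m ≤ D * suc s → Δ (T̄ m (suc s) ⊕ star D) ≡ D
Δ-T̄⊕star {m} s D m≤Ds = begin
  Δ (T̄ m (suc s) ⊕ star D)      ≡⟨ Δ-⊕ (T̄ m (suc s)) (star D) ⟩
  Δ (T̄ m (suc s)) ⊔ Δ (star D)  ≡⟨ cong (Δ (T̄ m (suc s)) ⊔_) (Δ-star D) ⟩
  Δ (T̄ m (suc s)) ⊔ D           ≡⟨ m≤n⇒m⊔n≡n (Δ-T̄-≤ s m≤Ds) ⟩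
  D                             ∎
  where open ≡-Reasoning

e-T̄⊕star : ∀ {m} s D → e (T̄ m s ⊕ star D) ≡ D + e (T̄ m s)
e-T̄⊕star {m} s D = begin
  e (T̄ m s ⊕ star D)    ≡⟨ e-⊕ (T̄ m s) (star D) ⟩
  e (T̄ m s) + e (star D) ≡⟨ cong (e (T̄ m s) +_) (e-star D) ⟩
  e (T̄ m s) + D          ≡⟨ +-comm (e (T̄ m s)) D ⟩
  D + e (T̄ m s)          ∎
  where open ≡-Reasoning

m∸n∸1+suc[n]≡m : ∀ {m n} → n < m → m ∸ n ∸ 1 + suc n ≡ m
m∸n∸1+suc[n]≡m {m} {n} n<m = begin
  m ∸ n ∸ 1 + suc n    ≡⟨ cong (_+ suc n) (∸-+-assoc m n 1) ⟩
  m ∸ (n + 1) + suc n  ≡⟨ cong (λ x → m ∸ x + suc n) (+-comm n 1) ⟩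
  m ∸ suc n + suc n    ≡⟨ m∸n+n≡m n<m ⟩
  m                    ∎
  where open ≡-Reasoning

proposition2p2 : (n r k D : ℕ) → 3 ≤ r → 2 ≤ k → n ≡ k * r
    → n ≤ D * (r ∸ 1) → D ≤ n ∸ r
    → Σ (Graph n) (λ G₂ → (Δ G₂ ≡ D)
        × (e G₂ ≡ D + e (T̄ (n ∸ D ∸ 1) (r ∸ 2)))
        × ¬ HasEquitableColouring G₂ k)
proposition2p2 n r@(suc (suc (suc s))) k@(suc _) D (s≤s (s≤s (s≤s _))) (s≤s _) n≡kr n≤D[r-1] D≤n-r =
  subst (λ N → Σ (Graph N) (λ G₂ → (Δ G₂ ≡ D) × (e G₂ ≡ D + e (T̄ m (suc s))) × ¬ HasEquitableColouring G₂ k))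
    m+D+1≡n
    ( T̄ m (suc s) ⊕ star D
    , Δ-T̄⊕star s D m≤D[r-2]
    , e-T̄⊕star {m} (suc s) D
    , T̄⊕star-notEquitable s D (trans m+D+1≡n n≡kr) ≤-refl )
  where
  open ≤-Reasoning
  m : ℕ
  m = n ∸ D ∸ 1

  D<n : D < n
  D<n = begin-strict
    D          <⟨ m<m+n D z<s ⟩
    D + r      ≤⟨ +-monoˡ-≤ r D≤n-r ⟩
    n ∸ r + r  ≡⟨ m∸n+n≡m (subst (r ≤_) (sym n≡kr) (m≤m+n r _)) ⟩
    n          ∎

  m+D+1≡n : m + suc D ≡ n
  m+D+1≡n = m∸n∸1+suc[n]≡m D<n

  m≤D[r-2] : m ≤ D * suc s
  m≤D[r-2] = begin
    n ∸ D ∸ 1          ≤⟨ m∸n≤m (n ∸ D) 1 ⟩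
    n ∸ D              ≤⟨ ∸-monoˡ-≤ D (subst (n ≤_) (*-suc D (suc s)) n≤D[r-1]) ⟩
    D + D * suc s ∸ D  ≡⟨ m+n∸m≡n D (D * suc s) ⟩
    D * suc s          ∎
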